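{- Let $k\geq 1$ be an integer and let $G$ be a self-complementary graph with an antimorphism $\tau$ whose decomposition into disjoint cycles contains the cycle $$(a_1\, b_1\, c_1\, d_1\, a_2\, b_2\, c_2\, d_2\, \dots\, a_k\, b_k\, c_k\, d_k)$$ (i.e. $\tau(a_i)=b_i$, $\tau(b_i)=c_i$, $\tau(c_i)=d_i$, $\tau(d_i)=a_{i+1}$, subscripts taken modulo $k$). Put $A=\{a_1,\dots,a_k\}$, $B=\{b_1,\dots,b_k\}$, $C=\{c_1,\dots,c_k\}$, $D=\{d_1,\dots,d_k\}$. Then at least one of the following holds: (1) there exist integers $i,j$ such that $\{a_1, b_i, a_{1+j}, b_{i+j}\}$ induces a path $P_4$ on four vertices in $G$ for which the circular permutation $(a_1\, b_i\, a_{1+j}\, b_{i+j})$ is an antimorphism (of this induced $P_4$); (2) $(A,B,C,D)$ is a symmetric partition of $G[A\cup B\cup C\cup D]$; (3) $(B,C,D,A)$ is a symmetric partition of $G[A\cup B\cup C\cup D]$.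
   Context: Graphs are finite, simple and undirected. $G[X]$ denotes the subgraph of $G$ induced by $X$. An antimorphism of $G$ is a bijection $\tau:V(G)\to V(G)$ such that for all distinct $a,b$, $ab\in E(G)$ if and only if $\tau(a)\tau(b)\notin E(G)$; $G$ is self-complementary if it has an antimorphism. $(x_1\,x_2\,\dots\,x_m)$ denotes the circular permutation sending $x_i$ to $x_{i+1}$ (indices mod $m$). Subscripts of $a_i,b_i,c_i,d_i$ are taken modulo $k$. A symmetric partition of a graph $H$ is a partition $(W,X,Y,Z)$ of $V(H)$ into four non-empty sets such that there are no edges between $W$ and $Z$, no edges between $X$ and $Y$, every vertex of $W$ is adjacent to every vertex of $X$, and every vertex of $Y$ is adjacent to every vertex of $Z$. -}

module Defs where

open import Data.Nat using (ℕ; NonZero)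
open import Data.Nat.DivMod using (_mod_)
open import Data.Fin using (Fin; zero; suc)
open import Data.Bool using (Bool; true; false; not)
open import Data.Product using (_×_; _,_; ∃)
open import Function.Definitions using (Injective; Bijective)
open import Relation.Binary.PropositionalEquality using (_≡_; _≢_)

record Graph (n : ℕ) : Set where
  field
    adj   : Fin n → Fin n → Bool
    sym   : ∀ u v → adj u v ≡ adj v u
    irrefl : ∀ v → adj v v ≡ false
open Graph public

IsAntimorphism : ∀ {n} → Graph n → (Fin n → Fin n) → Set
IsAntimorphism G τ =
  Bijective _≡_ _≡_ τ ×
  (∀ u v → u ≢ v → adj G (τ u) (τ v) ≡ not (adj G u v))

-- Index i taken modulo k (0-based: a_1 of the paper is a (0 mod k)).
ix : (i k : ℕ) .{{_ : NonZero k}} → Fin k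
ix i k = i mod k

-- The four families a,b,c,d : Fin k → Fin n are pairwise distinct vertices
-- (4k distinct vertices, as they form one cycle of τ of length 4k).
cycVertex : ∀ {k n} (a b c d : Fin k → Fin n) → Fin 4 × Fin k → Fin n
cycVertex a b c d (zero , i) = a i
cycVertex a b c d (suc zero , i) = b i
cycVertex a b c d (suc (suc zero) , i) = c i
cycVertex a b c d (suc (suc (suc zero)) , i) = d i

p4adj : Fin 4 → Fin 4 → Bool
p4adj zero (suc zero) = true
p4adj (suc zero) zero = true
p4adj (suc zero) (suc (suc zero)) = true
p4adj (suc (suc zero)) (suc zero) = true
p4adj (suc (suc zero)) (suc (suc (suc zero))) = true
p4adj (suc (suc (suc zero))) (suc (suc zero)) = true
p4adj _ _ = false

next4 : Fin 4 → Fin 4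
next4 zero = suc zero
next4 (suc zero) = suc (suc zero)
next4 (suc (suc zero)) = suc (suc (suc zero))
next4 (suc (suc (suc zero))) = zero

InducesP4 : ∀ {n} → Graph n → (Fin 4 → Fin n) → Set
InducesP4 G x =
  Injective _≡_ _≡_ x ×
  ∃ λ (π : Fin 4 → Fin 4) → Bijective _≡_ _≡_ π ×
    (∀ s t → adj G (x (π s)) (x (π t)) ≡ p4adj s t)

CircAntimorphism : ∀ {n} → Graph n → (Fin 4 → Fin n) → Set
CircAntimorphism G x =
  ∀ s t → s ≢ t → adj G (x (next4 s)) (x (next4 t)) ≡ not (adj G (x s) (x t))

quad : ∀ {n} → Fin n → Fin n → Fin n → Fin n → Fin 4 → Fin n
quad p q r s zero = p
quad p q r s (suc zero) = q
quad p q r s (suc (suc zero)) = r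
quad p q r s (suc (suc (suc zero))) = s

-- (W,X,Y,Z) symmetric partition of G[W ∪ X ∪ Y ∪ Z], for parts given as
-- the images of W X Y Z : Fin k → Fin n (these parts are non-empty as k ≥ 1
-- and disjoint/covering by the distinctness hypothesis on the cycle).
SymmetricPartition : ∀ {n k} → Graph n → (W X Y Z : Fin k → Fin n) → Set
SymmetricPartition G W X Y Z =
  (∀ i j → adj G (W i) (Z j) ≡ false) ×
  (∀ i j → adj G (X i) (Y j) ≡ false) ×
  (∀ i j → adj G (W i) (X j) ≡ true) ×
  (∀ i j → adj G (Y i) (Z j) ≡ true)

module Submission where

-- Applying τ four times moves every vertex one step along the cycle and preserves adjacency, so
-- whether a_t b_s is an edge depends only on s − t modulo k: a k-periodic two-colouring f of ℕ;
-- likewise a_t a_{t+j} depends only on j. A zigzag f m = f (m + 2d) ≠ f (m + d) gives the quadrangle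
-- a₁, b_{m+d}, a_{1+d}, b_{m+2d}: its four sides alternate and its diagonals are complementary, so it
-- is a P4 which the rotation maps onto its complement. Without zigzags a colour change at consecutive
-- positions spreads to both sides until it contradicts periodicity, so f is constant, and transporting
-- that constant by τ and τ² gives one of the two symmetric partitions.


open import Defs hiding (sym)
open import Data.Bool using (Bool; true; false; not)
open import Data.Bool.Properties using (_≟_; ¬-not; not-involutive)
open import Data.Fin using (Fin; zero; suc; toℕ; fromℕ<; #_)
open import Data.Fin.Properties as Fin using (toℕ<n; toℕ-fromℕ<; fromℕ<-toℕ; fromℕ<-cong; any?; all?)
open import Data.Nat using (ℕ; zero; suc; NonZero; _+_; _*_; _∸_; _<_; _≤_; _<?_; pred; >-nonZero; z≤n; s≤s)
open import Data.Nat.DivMod using (_%_; _/_; m%n<n; m<n⇒m%n≡m; [m+n]%n≡m%n; %-distribˡ-+; m≡m%n+[m/n]*n)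
open import Data.Nat.Divisibility using (divides; ∣⇒≤)
open import Data.Nat.Properties using (+-identityʳ; +-suc; +-comm; +-assoc; +-cancelˡ-≡; m∸n+n≡m; <⇒≤; <⇒≱; <-trans; ≤-reflexive; n<1+n; suc-pred)
open import Data.Product using (_×_; _,_; proj₁; proj₂; ∃; ∃₂)
open import Data.Product.Properties using (,-injectiveˡ; ,-injectiveʳ)
open import Data.Sum as Sum using (_⊎_; inj₁; inj₂)
open import Data.Empty using (⊥; ⊥-elim)
open import Function using (_∘_)
open import Function.Definitions using (Injective; Bijective; StrictlyInverseˡ; StrictlyInverseʳ)
open import Function.Consequences.Propositional using (inverseᵇ⇒bijective; strictlyInverseˡ⇒inverseˡ; strictlyInverseʳ⇒inverseʳ)
open import Relation.Nullary using (¬_; Dec; yes; no)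
open import Relation.Nullary.Decidable using (True; toWitness; decidable-stable; ¬?; _×-dec_; _→-dec_)
open import Relation.Binary.PropositionalEquality using (_≡_; _≢_; refl; sym; trans; cong; cong₂; subst; subst₂; ≢-sym; module ≡-Reasoning)

-- Two-colourings of ℕ

Zigzag : (ℕ → Bool) → ℕ → ℕ → Set
Zigzag f m d = f m ≡ f (m + d + d) × f (m + d) ≢ f m

ZigzagFree : ℕ → (ℕ → Bool) → Set
ZigzagFree k f = ∀ m d → 0 < d → d < k → ¬ Zigzag f m d

Periodic : ℕ → (ℕ → Bool) → Set
Periodic k f = ∀ x → f (x + k) ≡ f x

module _ {k : ℕ} {f : ℕ → Bool} (free : ZigzagFree k f) where

  no-double-flip : ∀ {x d} → 0 < d → d < k → f x ≢ f (x + d) → f (x + d) ≢ f (x + d + d) → ⊥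
  no-double-flip {x} {d} 0<d d<k x≢y y≢z =
    free x d 0<d d<k (trans (¬-not x≢y) (sym (¬-not (≢-sym y≢z))) , ≢-sym x≢y)

  no-flip-after : ∀ {x y z d} → 0 < d → d < k → y ≡ x + d → z ≡ y + d → f x ≢ f y → f z ≡ f y
  no-flip-after 0<d d<k refl refl x≢y =
    decidable-stable (_ ≟ _) (λ z≢y → no-double-flip 0<d d<k x≢y (≢-sym z≢y))

  no-flip-before : ∀ {x y z d} → 0 < d → d < k → y ≡ x + d → z ≡ y + d → f y ≢ f z → f x ≡ f y
  no-flip-before 0<d d<k refl refl y≢z =
    decidable-stable (_ ≟ _) (λ x≢y → no-double-flip 0<d d<k x≢y y≢z)

  -- A flip between g and g + 1 forces f to be constant on [g − j, g] and on [g + 1, g + 1 + j].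
  flip-spreads : ∀ j → j < k → ∀ m g → g ≡ m + j → f g ≢ f (suc g) →
                 f m ≢ f (suc g) × f g ≢ f (suc (g + j))
  flip-spreads zero _ m g g≡m+0 flip =
    subst (λ h → f h ≢ f (suc g)) (trans g≡m+0 (+-identityʳ m)) flip ,
    subst (λ h → f g ≢ f (suc h)) (sym (+-identityʳ g)) flip
  flip-spreads (suc j) j<k m g g≡m+j flip =
    (λ eq → flip (trans (sym left) eq)) , (λ eq → flip (trans eq right))
    where
    ih = flip-spreads j (<-trans (n<1+n j) j<k) (suc m) g (trans g≡m+j (+-suc m j)) flip
    left : f m ≡ f g
    left = no-flip-before (s≤s z≤n) j<k g≡m+j (sym (+-suc g j)) (proj₂ ih)
    right : f (suc (g + suc j)) ≡ f (suc g)
    right = no-flip-after (s≤s z≤n) j<k (cong suc g≡m+j) refl (proj₁ ih)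

  zigzag-free⇒constant : .{{_ : NonZero k}} → Periodic k f → ∀ m → f m ≡ f 0
  zigzag-free⇒constant per zero = refl
  zigzag-free⇒constant per (suc m) = trans (sym (no-flip m)) (zigzag-free⇒constant per m)
    where
    c+k≡ : ∀ c → c + k ≡ suc c + pred k
    c+k≡ c = trans (cong (c +_) (sym (suc-pred k))) (+-suc c (pred k))
    no-flip : ∀ c → f c ≡ f (suc c)
    no-flip c = decidable-stable (_ ≟ _) λ flip →
      proj₁ (flip-spreads (pred k) (≤-reflexive (suc-pred k)) (suc c) (c + k) (c+k≡ c)
              (λ eq → flip (trans (sym (per c)) (trans eq (per (suc c))))))
            (sym (per (suc c)))

module _ {k : ℕ} .{{_ : NonZero k}} {f : ℕ → Bool} (per : Periodic k f) where

  periodic-* : ∀ x q → f (x + q * k) ≡ f x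
  periodic-* x zero = cong f (+-identityʳ x)
  periodic-* x (suc q) = begin
    f (x + (k + q * k)) ≡⟨ cong f (trans (cong (x +_) (+-comm k (q * k))) (sym (+-assoc x (q * k) k))) ⟩
    f (x + q * k + k)   ≡⟨ per (x + q * k) ⟩
    f (x + q * k)       ≡⟨ periodic-* x q ⟩
    f x                 ∎
    where open ≡-Reasoning

  periodic-% : ∀ m y → f (m + y) ≡ f (m % k + y)
  periodic-% m y = begin
    f (m + y)                   ≡⟨ cong (λ m′ → f (m′ + y)) (m≡m%n+[m/n]*n m k) ⟩
    f (m % k + m / k * k + y)   ≡⟨ cong f (+-assoc (m % k) (m / k * k) y) ⟩
    f (m % k + (m / k * k + y)) ≡⟨ cong (λ z → f (m % k + z)) (+-comm (m / k * k) y) ⟩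
    f (m % k + (y + m / k * k)) ≡⟨ cong f (sym (+-assoc (m % k) y (m / k * k))) ⟩
    f (m % k + y + m / k * k)   ≡⟨ periodic-* (m % k + y) (m / k) ⟩
    f (m % k + y)               ∎
    where open ≡-Reasoning

  zigzag-% : ∀ {m d} → Zigzag f m d → Zigzag f (m % k) d
  zigzag-% {m} {d} (ends , middle) =
    trans (sym shift₀) (trans ends shift₂) , (λ eq → middle (trans (periodic-% m d) (trans eq (sym shift₀))))
    where
    shift₀ : f m ≡ f (m % k)
    shift₀ = trans (cong f (sym (+-identityʳ m))) (trans (periodic-% m 0) (cong f (+-identityʳ _)))
    shift₂ : f (m + d + d) ≡ f (m % k + d + d)
    shift₂ = trans (cong f (+-assoc m d d)) (trans (periodic-% m (d + d)) (cong f (sym (+-assoc _ d d))))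

  zigzag? : ∀ m d → Dec (Zigzag f m d)
  zigzag? m d = (_ ≟ _) ×-dec ¬? (_ ≟ _)

  zigzag-or-constant : (∃₂ λ m d → 0 < d × d < k × Zigzag f m d) ⊎ (∀ m → f m ≡ f 0)
  zigzag-or-constant
    with any? {P = λ m → ∃ λ (d : Fin k) → 0 < toℕ d × Zigzag f (toℕ m) (toℕ d)}
              (λ m → any? λ d → (0 <? toℕ d) ×-dec zigzag? (toℕ m) (toℕ d))
  ... | yes (m , d , 0<d , zz) = inj₁ (toℕ m , toℕ d , 0<d , toℕ<n d , zz)
  ... | no none = inj₂ (zigzag-free⇒constant free per)
    where
    free : ZigzagFree k f
    free m d 0<d d<k zz = none (fromℕ< (m%n<n m k) , fromℕ< d<k ,
      subst₂ (λ m′ d′ → 0 < d′ × Zigzag f m′ d′)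
             (sym (toℕ-fromℕ< (m%n<n m k))) (sym (toℕ-fromℕ< d<k)) (0<d , zigzag-% zz))

-- Four vertices

symMatrix4 : (e01 e02 e03 e12 e13 e23 : Bool) → Fin 4 → Fin 4 → Bool
symMatrix4 e01 e02 e03 e12 e13 e23 = M
  where
  M : Fin 4 → Fin 4 → Bool
  M zero (suc zero) = e01
  M zero (suc (suc zero)) = e02
  M zero (suc (suc (suc zero))) = e03
  M (suc zero) (suc (suc zero)) = e12
  M (suc zero) (suc (suc (suc zero))) = e13
  M (suc (suc zero)) (suc (suc (suc zero))) = e23
  M (suc zero) zero = e01
  M (suc (suc zero)) zero = e02
  M (suc (suc (suc zero))) zero = e03
  M (suc (suc zero)) (suc zero) = e12
  M (suc (suc (suc zero))) (suc zero) = e13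
  M (suc (suc (suc zero))) (suc (suc zero)) = e23
  M _ _ = false

module _ {n : ℕ} (G : Graph n) (x : Fin 4 → Fin n) where

  adj-quad : ∀ {e01 e02 e03 e12 e13 e23} →
             adj G (x (# 0)) (x (# 1)) ≡ e01 → adj G (x (# 0)) (x (# 2)) ≡ e02 →
             adj G (x (# 0)) (x (# 3)) ≡ e03 → adj G (x (# 1)) (x (# 2)) ≡ e12 →
             adj G (x (# 1)) (x (# 3)) ≡ e13 → adj G (x (# 2)) (x (# 3)) ≡ e23 →
             ∀ s t → adj G (x s) (x t) ≡ symMatrix4 e01 e02 e03 e12 e13 e23 s t
  adj-quad h01 h02 h03 h12 h13 h23 = adj-x
    where
    flipped : ∀ {s t e} → adj G (x s) (x t) ≡ e → adj G (x t) (x s) ≡ e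
    flipped = trans (Graph.sym G _ _)
    adj-x : ∀ s t → adj G (x s) (x t) ≡ symMatrix4 _ _ _ _ _ _ s t
    adj-x zero (suc zero) = h01
    adj-x zero (suc (suc zero)) = h02
    adj-x zero (suc (suc (suc zero))) = h03
    adj-x (suc zero) (suc (suc zero)) = h12
    adj-x (suc zero) (suc (suc (suc zero))) = h13
    adj-x (suc (suc zero)) (suc (suc (suc zero))) = h23
    adj-x (suc zero) zero = flipped h01
    adj-x (suc (suc zero)) zero = flipped h02
    adj-x (suc (suc (suc zero))) zero = flipped h03
    adj-x (suc (suc zero)) (suc zero) = flipped h12
    adj-x (suc (suc (suc zero))) (suc zero) = flipped h13
    adj-x (suc (suc (suc zero))) (suc (suc zero)) = flipped h23
    adj-x zero zero = irrefl G _
    adj-x (suc zero) (suc zero) = irrefl G _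
    adj-x (suc (suc zero)) (suc (suc zero)) = irrefl G _
    adj-x (suc (suc (suc zero))) (suc (suc (suc zero))) = irrefl G _

quad-injective : ∀ {n} {p q r s : Fin n} → p ≢ q → p ≢ r → p ≢ s → q ≢ r → q ≢ s → r ≢ s →
                 Injective _≡_ _≡_ (quad p q r s)
quad-injective pq pr ps qr qs rs = injective
  where
  injective : Injective _≡_ _≡_ (quad _ _ _ _)
  injective {zero} {zero} _ = refl
  injective {suc zero} {suc zero} _ = refl
  injective {suc (suc zero)} {suc (suc zero)} _ = refl
  injective {suc (suc (suc zero))} {suc (suc (suc zero))} _ = refl
  injective {zero} {suc zero} eq = ⊥-elim (pq eq)
  injective {zero} {suc (suc zero)} eq = ⊥-elim (pr eq)
  injective {zero} {suc (suc (suc zero))} eq = ⊥-elim (ps eq)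
  injective {suc zero} {suc (suc zero)} eq = ⊥-elim (qr eq)
  injective {suc zero} {suc (suc (suc zero))} eq = ⊥-elim (qs eq)
  injective {suc (suc zero)} {suc (suc (suc zero))} eq = ⊥-elim (rs eq)
  injective {suc zero} {zero} eq = ⊥-elim (pq (sym eq))
  injective {suc (suc zero)} {zero} eq = ⊥-elim (pr (sym eq))
  injective {suc (suc (suc zero))} {zero} eq = ⊥-elim (ps (sym eq))
  injective {suc (suc zero)} {suc zero} eq = ⊥-elim (qr (sym eq))
  injective {suc (suc (suc zero))} {suc zero} eq = ⊥-elim (qs (sym eq))
  injective {suc (suc (suc zero))} {suc (suc zero)} eq = ⊥-elim (rs (sym eq))

-- The quadrangle a₁, bᵢ, a₁₊ⱼ, bᵢ₊ⱼ of the zigzag case: q is the colour of the ends of the zigzag,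
-- g the adjacency of the two a-vertices.
zigzagAdj : Bool → Bool → Fin 4 → Fin 4 → Bool
zigzagAdj q g = symMatrix4 (not q) g q q (not g) (not q)

zigzagPath zigzagPath⁻¹ : Bool → Bool → Fin 4 → Fin 4
zigzagPath false false = quad (# 0) (# 1) (# 3) (# 2)
zigzagPath false true = quad (# 1) (# 0) (# 2) (# 3)
zigzagPath true false = quad (# 2) (# 1) (# 3) (# 0)
zigzagPath true true = quad (# 1) (# 2) (# 0) (# 3)
zigzagPath⁻¹ false false = quad (# 0) (# 1) (# 3) (# 2)
zigzagPath⁻¹ false true = quad (# 1) (# 0) (# 2) (# 3)
zigzagPath⁻¹ true false = quad (# 3) (# 1) (# 0) (# 2)
zigzagPath⁻¹ true true = quad (# 2) (# 0) (# 1) (# 3)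

by-evaluation : {P : Bool → Bool → Set} (P? : ∀ q g → Dec (P q g)) →
                True (P? false false) → True (P? false true) → True (P? true false) → True (P? true true) →
                ∀ q g → P q g
by-evaluation P? ff _ _ _ false false = toWitness ff
by-evaluation P? _ ft _ _ false true = toWitness ft
by-evaluation P? _ _ tf _ true false = toWitness tf
by-evaluation P? _ _ _ tt true true = toWitness tt

zigzagAdj-path : ∀ q g s t → zigzagAdj q g (zigzagPath q g s) (zigzagPath q g t) ≡ p4adj s t
zigzagAdj-path = by-evaluation (λ q g → all? λ s → all? λ t → _ ≟ _) _ _ _ _

zigzagAdj-rotate : ∀ q g s t → s ≢ t → zigzagAdj q g (next4 s) (next4 t) ≡ not (zigzagAdj q g s t)
zigzagAdj-rotate = by-evaluation (λ q g → all? λ s → all? λ t → ¬? (s Fin.≟ t) →-dec (_ ≟ _)) _ _ _ _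

zigzagPath-bijective : ∀ q g → Bijective _≡_ _≡_ (zigzagPath q g)
zigzagPath-bijective q g = inverseᵇ⇒bijective
  (strictlyInverseˡ⇒inverseˡ (zigzagPath q g) (right-inverse q g) ,
   strictlyInverseʳ⇒inverseʳ (zigzagPath q g) (left-inverse q g))
  where
  right-inverse : ∀ q g → StrictlyInverseˡ _≡_ (zigzagPath q g) (zigzagPath⁻¹ q g)
  right-inverse = by-evaluation (λ q g → all? λ s → _ Fin.≟ s) _ _ _ _
  left-inverse : ∀ q g → StrictlyInverseʳ _≡_ (zigzagPath q g) (zigzagPath⁻¹ q g)
  left-inverse = by-evaluation (λ q g → all? λ s → _ Fin.≟ s) _ _ _ _

zigzag-quad : ∀ {n} (G : Graph n) (x : Fin 4 → Fin n) {q g} → Injective _≡_ _≡_ x →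
              (∀ s t → adj G (x s) (x t) ≡ zigzagAdj q g s t) → InducesP4 G x × CircAntimorphism G x
zigzag-quad G x {q} {g} x-injective adj-x =
  (x-injective , zigzagPath q g , zigzagPath-bijective q g ,
   λ s t → trans (adj-x _ _) (zigzagAdj-path q g s t)) ,
  λ s t s≢t → trans (adj-x _ _) (trans (zigzagAdj-rotate q g s t s≢t) (cong not (sym (adj-x s t))))

module Antimorphism {n : ℕ} (G : Graph n) (τ : Fin n → Fin n) (anti : IsAntimorphism G τ) where

  adj-τ : ∀ {u v u′ v′} → τ u ≡ u′ → τ v ≡ v′ → u ≢ v → adj G u′ v′ ≡ not (adj G u v)
  adj-τ refl refl u≢v = proj₂ anti _ _ u≢v

  adj-τ² : ∀ {u v u′ v′} → τ (τ u) ≡ u′ → τ (τ v) ≡ v′ → adj G u′ v′ ≡ adj G u v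
  adj-τ² {u} {v} refl refl with u Fin.≟ v
  ... | yes refl = trans (irrefl G _) (sym (irrefl G u))
  ... | no u≢v = trans (adj-τ refl refl (u≢v ∘ proj₁ (proj₁ anti)))
                       (trans (cong not (adj-τ refl refl u≢v)) (not-involutive _))

adj-shift : ∀ {n} (G : Graph n) {u v : ℕ → Fin n} →
            (∀ t s → adj G (u (suc t)) (v (suc s)) ≡ adj G (u t) (v s)) →
            ∀ t x y → adj G (u (x + t)) (v (y + t)) ≡ adj G (u x) (v y)
adj-shift G {u} {v} step zero x y = cong₂ (λ i j → adj G (u i) (v j)) (+-identityʳ x) (+-identityʳ y)
adj-shift G {u} {v} step (suc t) x y = begin
  adj G (u (x + suc t)) (v (y + suc t))     ≡⟨ cong₂ (λ i j → adj G (u i) (v j)) (+-suc x t) (+-suc y t) ⟩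
  adj G (u (suc (x + t))) (v (suc (y + t))) ≡⟨ step (x + t) (y + t) ⟩
  adj G (u (x + t)) (v (y + t))             ≡⟨ adj-shift G step t x y ⟩
  adj G (u x) (v y)                         ∎
  where open ≡-Reasoning

module _ {k : ℕ} .{{_ : NonZero k}} where

  ix-toℕ : (i : Fin k) → ix (toℕ i) k ≡ i
  ix-toℕ i = trans (fromℕ<-cong _ _ (m<n⇒m%n≡m (toℕ<n i)) _ (toℕ<n i)) (fromℕ<-toℕ i _)

  ix-+k : ∀ t → ix (t + k) k ≡ ix t k
  ix-+k t = fromℕ<-cong _ _ ([m+n]%n≡m%n t k) _ _

  ix-+-injective : ∀ t d → 0 < d → d < k → ix t k ≢ ix (t + d) k
  ix-+-injective t d 0<d d<k eq = <⇒≱ d<k (∣⇒≤ {{>-nonZero 0<d}} (divides ((r + d) / k) d≡qk))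
    where
    open ≡-Reasoning
    r = t % k
    r≡[r+d]%k : r ≡ (r + d) % k
    r≡[r+d]%k = begin
      r                  ≡⟨ toℕ-fromℕ< (m%n<n t k) ⟨
      toℕ (ix t k)       ≡⟨ cong toℕ eq ⟩
      toℕ (ix (t + d) k) ≡⟨ toℕ-fromℕ< (m%n<n (t + d) k) ⟩
      (t + d) % k        ≡⟨ %-distribˡ-+ t d k ⟩
      (r + d % k) % k    ≡⟨ cong (λ e → (r + e) % k) (m<n⇒m%n≡m d<k) ⟩
      (r + d) % k        ∎
    d≡qk : d ≡ (r + d) / k * k
    d≡qk = +-cancelˡ-≡ r d _ (trans (m≡m%n+[m/n]*n (r + d) k) (cong (_+ (r + d) / k * k) (sym r≡[r+d]%k)))

-- The cycle (a₁ b₁ c₁ d₁ … aₖ bₖ cₖ dₖ) of the antimorphism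

module Cycle {k : ℕ} .{{_ : NonZero k}} {n : ℕ} (G : Graph n) (τ : Fin n → Fin n)
  (anti : IsAntimorphism G τ) (a b c d : Fin k → Fin n)
  (distinct : Injective _≡_ _≡_ (cycVertex a b c d))
  (τ-a : ∀ i → τ (a (ix i k)) ≡ b (ix i k))
  (τ-b : ∀ i → τ (b (ix i k)) ≡ c (ix i k))
  (τ-c : ∀ i → τ (c (ix i k)) ≡ d (ix i k))
  (τ-d : ∀ i → τ (d (ix i k)) ≡ a (ix (i + 1) k)) where

  open Antimorphism G τ anti

  A B C D : ℕ → Fin n
  A t = a (ix t k)
  B t = b (ix t k)
  C t = c (ix t k)
  D t = d (ix t k)

  class-distinct : ∀ {p p′ i j} → p ≢ p′ → cycVertex a b c d (p , i) ≢ cycVertex a b c d (p′ , j)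
  class-distinct {p} {p′} {i} {j} p≢p′ = p≢p′ ∘ ,-injectiveˡ ∘ distinct {p , i} {p′ , j}

  index-distinct : ∀ {p i j} → i ≢ j → cycVertex a b c d (p , i) ≢ cycVertex a b c d (p , j)
  index-distinct {p} {i} {j} i≢j = i≢j ∘ ,-injectiveʳ ∘ distinct {p , i} {p , j}

  A≢B : ∀ t s → A t ≢ B s
  A≢B t s = class-distinct {# 0} {# 1} (λ ())

  A≢D : ∀ t s → A t ≢ D s
  A≢D t s = class-distinct {# 0} {# 3} (λ ())

  τ-D : ∀ t → τ (D t) ≡ A (suc t)
  τ-D t = trans (τ-d t) (cong A (+-comm t 1))

  τ²-A : ∀ t → τ (τ (A t)) ≡ C t
  τ²-A t = trans (cong τ (τ-a t)) (τ-b t)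

  τ²-B : ∀ t → τ (τ (B t)) ≡ D t
  τ²-B t = trans (cong τ (τ-b t)) (τ-c t)

  τ²-C : ∀ t → τ (τ (C t)) ≡ A (suc t)
  τ²-C t = trans (cong τ (τ-c t)) (τ-D t)

  τ²-D : ∀ t → τ (τ (D t)) ≡ B (suc t)
  τ²-D t = trans (cong τ (τ-D t)) (τ-a (suc t))

  adj-B-C : ∀ t s → adj G (B t) (C s) ≡ not (adj G (A t) (B s))
  adj-B-C t s = adj-τ (τ-a t) (τ-b s) (A≢B t s)

  adj-C-D : ∀ t s → adj G (C t) (D s) ≡ adj G (A t) (B s)
  adj-C-D t s = adj-τ² (τ²-A t) (τ²-B s)

  adj-A-D : ∀ t s → adj G (A t) (D s) ≡ not (adj G (A (suc s)) (B t))
  adj-A-D t s = begin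
    adj G (A t) (D s)                    ≡⟨ not-involutive _ ⟨
    not (not (adj G (A t) (D s)))        ≡⟨ cong not (adj-τ (τ-a t) (τ-D s) (A≢D t s)) ⟨
    not (adj G (B t) (A (suc s)))        ≡⟨ cong not (Graph.sym G _ _) ⟩
    not (adj G (A (suc s)) (B t))        ∎
    where open ≡-Reasoning

  -- τ⁴ is an automorphism moving every class one step along the cycle.
  adj-A-B-shift : ∀ t x y → adj G (A (x + t)) (B (y + t)) ≡ adj G (A x) (B y)
  adj-A-B-shift = adj-shift G λ t s →
    trans (adj-τ² (τ²-C t) (τ²-D s)) (adj-τ² (τ²-A t) (τ²-B s))

  adj-A-A-shift : ∀ t x y → adj G (A (x + t)) (A (y + t)) ≡ adj G (A x) (A y)
  adj-A-A-shift = adj-shift G λ t s →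
    trans (adj-τ² (τ²-C t) (τ²-C s)) (adj-τ² (τ²-A t) (τ²-A s))

  -- abAdj m is the adjacency of a_t and b_{t+m}, for every t.
  abAdj : ℕ → Bool
  abAdj m = adj G (A 0) (B m)

  abAdj-periodic : Periodic k abAdj
  abAdj-periodic x = cong (adj G (A 0) ∘ b) (ix-+k x)

  zigzag-P4 : ∀ {m d} → 0 < d → d < k → Zigzag abAdj m d →
              let x = quad (A 0) (B (m + d)) (A d) (B (m + d + d)) in InducesP4 G x × CircAntimorphism G x
  zigzag-P4 {m} {d} 0<d d<k (ends , middle) =
    zigzag-quad G _
      (quad-injective (A≢B 0 _) (index-distinct {# 0} (ix-+-injective 0 d 0<d d<k)) (A≢B 0 _)
                      (≢-sym (A≢B d _)) (index-distinct {# 1} (ix-+-injective (m + d) d 0<d d<k)) (A≢B d _))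
      (adj-quad G _ (¬-not middle) refl (sym ends) near-B-A far-B near-A-B)
    where
    near-B-A : adj G (B (m + d)) (A d) ≡ abAdj m
    near-B-A = trans (Graph.sym G _ _) (adj-A-B-shift d 0 m)
    near-A-B : adj G (A d) (B (m + d + d)) ≡ not (abAdj m)
    near-A-B = trans (adj-A-B-shift d 0 (m + d)) (¬-not middle)
    far-B : adj G (B (m + d)) (B (m + d + d)) ≡ not (adj G (A 0) (A d))
    far-B = trans (adj-τ (τ-a _) (τ-a _) (index-distinct {# 0} (ix-+-injective (m + d) d 0<d d<k)))
                  (cong not (trans (cong (adj G (A (m + d)) ∘ A) (+-comm (m + d) d)) (adj-A-A-shift (m + d) 0 d)))

  module _ (constant : ∀ m → abAdj m ≡ abAdj 0) where

    adj-A-B-constant : ∀ t s → t ≤ k → adj G (A t) (B s) ≡ abAdj 0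
    adj-A-B-constant t s t≤k = begin
      adj G (A t) (B s)                       ≡⟨ cong (adj G (A t) ∘ b) wrap ⟨
      adj G (A (0 + t)) (B (s + (k ∸ t) + t)) ≡⟨ adj-A-B-shift t 0 (s + (k ∸ t)) ⟩
      abAdj (s + (k ∸ t))                     ≡⟨ constant _ ⟩
      abAdj 0                                 ∎
      where
      open ≡-Reasoning
      wrap : ix (s + (k ∸ t) + t) k ≡ ix s k
      wrap = trans (cong (λ e → ix e k) (trans (+-assoc s (k ∸ t) t) (cong (s +_) (m∸n+n≡m t≤k)))) (ix-+k s)

    on-indices : ∀ {u v : Fin k → Fin n} {β} →
                 (∀ t s → t < k → s < k → adj G (u (ix t k)) (v (ix s k)) ≡ β) → ∀ i j → adj G (u i) (v j) ≡ β
    on-indices {u} {v} {β} h i j =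
      subst₂ (λ i′ j′ → adj G (u i′) (v j′) ≡ β) (ix-toℕ i) (ix-toℕ j) (h _ _ (toℕ<n i) (toℕ<n j))

    symmetric-partition : SymmetricPartition G a b c d ⊎ SymmetricPartition G b c d a
    symmetric-partition = by-colour (abAdj 0) refl
      where
      AB : ∀ {β} → abAdj 0 ≡ β → ∀ t s → t < k → s < k → adj G (A t) (B s) ≡ β
      AB eq t s t<k _ = trans (adj-A-B-constant t s (<⇒≤ t<k)) eq
      BA : ∀ {β} → abAdj 0 ≡ β → ∀ t s → t < k → s < k → adj G (B t) (A s) ≡ β
      BA eq t s t<k s<k = trans (Graph.sym G _ _) (AB eq s t s<k t<k)
      BC : ∀ {β} → abAdj 0 ≡ β → ∀ t s → t < k → s < k → adj G (B t) (C s) ≡ not β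
      BC eq t s t<k s<k = trans (adj-B-C t s) (cong not (AB eq t s t<k s<k))
      CD : ∀ {β} → abAdj 0 ≡ β → ∀ t s → t < k → s < k → adj G (C t) (D s) ≡ β
      CD eq t s t<k s<k = trans (adj-C-D t s) (AB eq t s t<k s<k)
      AD : ∀ {β} → abAdj 0 ≡ β → ∀ t s → t < k → s < k → adj G (A t) (D s) ≡ not β
      AD eq t s _ s<k = trans (adj-A-D t s) (cong not (trans (adj-A-B-constant (suc s) t s<k) eq))
      DA : ∀ {β} → abAdj 0 ≡ β → ∀ t s → t < k → s < k → adj G (D t) (A s) ≡ not β
      DA eq t s t<k s<k = trans (Graph.sym G _ _) (AD eq s t s<k t<k)
      by-colour : ∀ β → abAdj 0 ≡ β → SymmetricPartition G a b c d ⊎ SymmetricPartition G b c d a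
      by-colour true eq = inj₁ (on-indices (AD eq) , on-indices (BC eq) , on-indices (AB eq) , on-indices (CD eq))
      by-colour false eq = inj₂ (on-indices (BA eq) , on-indices (CD eq) , on-indices (BC eq) , on-indices (DA eq))

lemma4 : (k : ℕ) .{{_ : NonZero k}} → (n : ℕ) → (G : Graph n) → (τ : Fin n → Fin n) →
         IsAntimorphism G τ →
         (a b c d : Fin k → Fin n) →
         Injective _≡_ _≡_ (cycVertex a b c d) →
         (∀ i → τ (a (ix i k)) ≡ b (ix i k)) →
         (∀ i → τ (b (ix i k)) ≡ c (ix i k)) →
         (∀ i → τ (c (ix i k)) ≡ d (ix i k)) →
         (∀ i → τ (d (ix i k)) ≡ a (ix (i + 1) k)) →
         (∃₂ λ (i j : ℕ) →
            let x = quad (a (ix 0 k)) (b (ix i k)) (a (ix j k)) (b (ix (i + j) k))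
            in InducesP4 G x × CircAntimorphism G x)
         ⊎ SymmetricPartition G a b c d
         ⊎ SymmetricPartition G b c d a
lemma4 k n G τ anti a b c d distinct τ-a τ-b τ-c τ-d =
  Sum.map (λ (m , e , 0<e , e<k , zz) → m + e , e , zigzag-P4 0<e e<k zz) symmetric-partition
          (zigzag-or-constant abAdj-periodic)
  where open Cycle G τ anti a b c d distinct τ-a τ-b τ-c τ-d
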